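{- Let $H$ be a finite hypergraph and $g$ an automorphism of $H$. Then the map $f:\mathfrak{U}(H)\to\mathfrak{U}(H)$ given by $f(W_{E_0})=W_{E_{g(v)}(H)}$ for any $v\in W_{E_0}$ is well defined and is a unit-automorphism of $H$.
   Context: A hypergraph $H$ is a pair $(V(H),E(H))$ with $V(H)$ a nonempty finite set and $E(H)$ a set of nonempty subsets of $V(H)$. An automorphism of $H$ is a bijection $g:V(H)\to V(H)$ such that for every $e\subseteq V(H)$, $e\in E(H)$ iff $\{g(v):v\in e\}\in E(H)$. For $v\in V(H)$, $E_v(H)=\{e\in E(H):v\in e\}$. A unit is an equivalence class of $u\sim v\iff E_u(H)=E_v(H)$; $W_E$ denotes the unit whose vertices have star $E$, and $\mathfrak{U}(H)$ the set of units. Every hyperedge is a disjoint union of units. A unit-automorphism of $H$ is a bijection $f:\mathfrak{U}(H)\to\mathfrak{U}(H)$ such that for every collection of units $W_{E_1},\ldots,W_{E_k}$, $\bigcup_{i=1}^k W_{E_i}\in E(H)$ if and only if $\bigcup_{i=1}^k f(W_{E_i})\in E(H)$. -}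

module Defs where

open import Data.Nat using (ℕ; _≤_)
open import Data.Fin using (Fin)
open import Data.Fin.Subset using (Subset; _∈_; Nonempty; ⋃)
open import Data.List using (List; map)
open import Data.List.Relation.Unary.All using (All)
open import Data.List.Membership.Propositional renaming (_∈_ to _∈ₗ_)
open import Data.Product using (Σ; ∃; _×_)
open import Function.Bundles using (_⇔_; Inverse)
open import Relation.Binary.PropositionalEquality using (_≡_; setoid)

-- The hyperedge set E(H) is given as a finite list of subsets
-- (repetitions are irrelevant: only membership is ever used);
-- every hyperedge is nonempty.
record Hypergraph : Set where
  field
    n         : ℕ
    nonemptyV : 1 ≤ n
    edges     : List (Subset n)
    edgesNE   : All Nonempty edges
open Hypergraph public

IsEdge : (H : Hypergraph) → Subset (n H) → Set
IsEdge H e = e ∈ₗ edges H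

SameStar : (H : Hypergraph) → Fin (n H) → Fin (n H) → Set
SameStar H u v = (e : Subset (n H)) → (IsEdge H e × u ∈ e) ⇔ (IsEdge H e × v ∈ e)

-- W is the unit of v, i.e. W = W_{E_v(H)} = { u : E_u(H) = E_v(H) }
IsUnitOf : (H : Hypergraph) → Subset (n H) → Fin (n H) → Set
IsUnitOf H W v = (u : Fin (n H)) → u ∈ W ⇔ SameStar H u v

IsUnit : (H : Hypergraph) → Subset (n H) → Set
IsUnit H W = ∃ λ v → IsUnitOf H W v

IsImage : {m : ℕ} → (Fin m → Fin m) → Subset m → Subset m → Set
IsImage g e e' = ∀ x → x ∈ e' ⇔ (∃ λ v → v ∈ e × g v ≡ x)

IsAutomorphism : (H : Hypergraph) → Inverse (setoid (Fin (n H))) (setoid (Fin (n H))) → Set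
IsAutomorphism H g = ∀ e e' → IsImage (Inverse.to g) e e' → (IsEdge H e ⇔ IsEdge H e')

record IsUnitAutomorphism (H : Hypergraph) (f : Subset (n H) → Subset (n H)) : Set where
  field
    mapsUnits   : ∀ W → IsUnit H W → IsUnit H (f W)
    injective   : ∀ W W' → IsUnit H W → IsUnit H W' → f W ≡ f W' → W ≡ W'
    surjective  : ∀ W' → IsUnit H W' → ∃ λ W → IsUnit H W × f W ≡ W'
    unionEdge   : (Ws : List (Subset (n H))) → All (IsUnit H) Ws →
                  IsEdge H (⋃ Ws) ⇔ IsEdge H (⋃ (map f Ws))

{-# OPTIONS --safe #-}
-- The map of the theorem is W ↦ g(W), which is the preimage of W under g⁻¹.
-- Since g and g⁻¹ both pull hyperedges back to hyperedges, g preserves and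
-- reflects having the same star, so it maps the unit of v onto the unit of
-- g v; and images commute with unions, so the union condition is exactly
-- the automorphism property of g applied to the union.
module Submission where

open import Defs
open import Data.Bool using (false; _∨_)
open import Data.Fin using (Fin)
open import Data.Fin.Subset using (Subset; _∈_; _∪_; ⊥; ⋃)
open import Data.List using ([]; _∷_; map)
open import Data.Nat using (ℕ)
open import Data.Product using (Σ; _×_; _,_)
open import Data.Vec using (lookup; tabulate)
open import Data.Vec.Properties
  using ([]=⇒lookup; lookup⇒[]=; lookup∘tabulate; tabulate∘lookup; tabulate-cong;
         lookup-zipWith; lookup-replicate)
open import Function using (_∘_)
open import Function.Bundles using (Inverse; _⇔_; mk⇔; Equivalence)
open import Function.Properties.Equivalence using ()
  renaming (sym to ⇔-sym; trans to ⇔-trans)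
open import Relation.Binary.PropositionalEquality
open ≡-Reasoning

private
  variable
    a b : ℕ

subset-ext : {W V : Subset a} → (∀ i → lookup W i ≡ lookup V i) → W ≡ V
subset-ext {W = W} {V} W≗V =
  trans (sym (tabulate∘lookup W)) (trans (tabulate-cong W≗V) (tabulate∘lookup V))

preimage : (Fin a → Fin b) → Subset b → Subset a
preimage h W = tabulate (lookup W ∘ h)

module _ (h : Fin a → Fin b) where

  lookup-preimage : ∀ W i → lookup (preimage h W) i ≡ lookup W (h i)
  lookup-preimage W = lookup∘tabulate (lookup W ∘ h)

  ∈-preimage : ∀ {W x} → x ∈ preimage h W ⇔ h x ∈ W
  ∈-preimage {W} {x} = mk⇔
    (λ x∈ → lookup⇒[]= (h x) W (trans (sym (lookup-preimage W x)) ([]=⇒lookup x∈)))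
    (λ hx∈ → lookup⇒[]= x (preimage h W) (trans (lookup-preimage W x) ([]=⇒lookup hx∈)))

  preimage-⊥ : preimage h ⊥ ≡ ⊥
  preimage-⊥ = subset-ext λ i → begin
    lookup (preimage h ⊥) i  ≡⟨ lookup-preimage ⊥ i ⟩
    lookup ⊥ (h i)           ≡⟨ lookup-replicate (h i) false ⟩
    false                    ≡⟨ lookup-replicate i false ⟨
    lookup ⊥ i               ∎

  preimage-∪ : ∀ W V → preimage h (W ∪ V) ≡ preimage h W ∪ preimage h V
  preimage-∪ W V = subset-ext λ i → begin
    lookup (preimage h (W ∪ V)) i
      ≡⟨ lookup-preimage (W ∪ V) i ⟩
    lookup (W ∪ V) (h i)
      ≡⟨ lookup-zipWith _∨_ (h i) W V ⟩
    lookup W (h i) ∨ lookup V (h i)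
      ≡⟨ cong₂ _∨_ (lookup-preimage W i) (lookup-preimage V i) ⟨
    lookup (preimage h W) i ∨ lookup (preimage h V) i
      ≡⟨ lookup-zipWith _∨_ i (preimage h W) (preimage h V) ⟨
    lookup (preimage h W ∪ preimage h V) i
      ∎

  preimage-⋃ : ∀ Ws → preimage h (⋃ Ws) ≡ ⋃ (map (preimage h) Ws)
  preimage-⋃ []       = preimage-⊥
  preimage-⋃ (W ∷ Ws) = trans (preimage-∪ W (⋃ Ws)) (cong (preimage h W ∪_) (preimage-⋃ Ws))

module _ {h : Fin a → Fin b} {k : Fin b → Fin a} (k∘h : ∀ x → k (h x) ≡ x) where

  preimage-cancel : ∀ W → preimage h (preimage k W) ≡ W
  preimage-cancel W = subset-ext λ i → begin
    lookup (preimage h (preimage k W)) i  ≡⟨ lookup-preimage h (preimage k W) i ⟩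
    lookup (preimage k W) (h i)           ≡⟨ lookup-preimage k W (h i) ⟩
    lookup W (k (h i))                    ≡⟨ cong (lookup W) (k∘h i) ⟩
    lookup W i                            ∎

  preimage-injective : ∀ {W V} → preimage k W ≡ preimage k V → W ≡ V
  preimage-injective {W} {V} kW≡kV = begin
    W                          ≡⟨ preimage-cancel W ⟨
    preimage h (preimage k W)  ≡⟨ cong (preimage h) kW≡kV ⟩
    preimage h (preimage k V)  ≡⟨ preimage-cancel V ⟩
    V                          ∎

isImage-preimage : {h k : Fin a → Fin a} → (∀ x → h (k x) ≡ x) → (∀ x → k (h x) ≡ x) →
                   ∀ W → IsImage h W (preimage k W)
isImage-preimage {h = h} {k} h∘k k∘h W x = mk⇔
  (λ x∈ → k x , Equivalence.to (∈-preimage k) x∈ , h∘k x)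
  (λ { (v , v∈W , refl) → Equivalence.from (∈-preimage k) (subst (_∈ W) (sym (k∘h v)) v∈W) })

module _ (H : Hypergraph) where

  PullsBackEdges : (Fin (n H) → Fin (n H)) → Set
  PullsBackEdges h = ∀ e → IsEdge H e → IsEdge H (preimage h e)

  sameStar-sym : ∀ {u v} → SameStar H u v → SameStar H v u
  sameStar-sym u~v e = ⇔-sym (u~v e)

  sameStar-trans : ∀ {u v w} → SameStar H u v → SameStar H v w → SameStar H u w
  sameStar-trans u~v v~w e = ⇔-trans (u~v e) (v~w e)

  sameStar-pullsBack : ∀ {h u v} → PullsBackEdges h → SameStar H u v → SameStar H (h u) (h v)
  sameStar-pullsBack {h} h-pb u~v e =
    mk⇔ (along (Equivalence.to ∘ u~v)) (along (Equivalence.from ∘ u~v))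
    where
    along : ∀ {x y} → (∀ e → IsEdge H e × x ∈ e → IsEdge H e × y ∈ e) →
            IsEdge H e × h x ∈ e → IsEdge H e × h y ∈ e
    along x→y (e-edge , hx∈e) =
      let _ , y∈he = x→y (preimage h e) (h-pb e e-edge , Equivalence.from (∈-preimage h) hx∈e)
      in e-edge , Equivalence.to (∈-preimage h) y∈he

  isUnitOf-member : ∀ {W w v} → IsUnitOf H W w → v ∈ W → IsUnitOf H W v
  isUnitOf-member {W} {w} {v} W-unit v∈W u =
    ⇔-trans (W-unit u) (mk⇔ (λ u~w → sameStar-trans u~w (sameStar-sym v~w))
                            (λ u~v → sameStar-trans u~v v~w))
    where
    v~w : SameStar H v w
    v~w = Equivalence.to (W-unit v) v∈W

  module _ {h k : Fin (n H) → Fin (n H)}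
           (h∘k : ∀ x → h (k x) ≡ x) (k∘h : ∀ x → k (h x) ≡ x)
           (h-pb : PullsBackEdges h) (k-pb : PullsBackEdges k) where

    sameStar-adjoint : ∀ {u v} → SameStar H (k u) v ⇔ SameStar H u (h v)
    sameStar-adjoint {u} {v} = mk⇔
      (λ ku~v → subst (λ z → SameStar H z (h v)) (h∘k u) (sameStar-pullsBack h-pb ku~v))
      (λ u~hv → subst (SameStar H (k u)) (k∘h v) (sameStar-pullsBack k-pb u~hv))

    isUnitOf-preimage : ∀ {W v} → IsUnitOf H W v → IsUnitOf H (preimage k W) (h v)
    isUnitOf-preimage W-unit u = ⇔-trans (∈-preimage k) (⇔-trans (W-unit (k u)) sameStar-adjoint)

module _ (H : Hypergraph) (g : Inverse (setoid (Fin (n H))) (setoid (Fin (n H))))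
         (aut : IsAutomorphism H g) where

  open Inverse g using (to; from)
    renaming (strictlyInverseˡ to to∘from; strictlyInverseʳ to from∘to)

  isEdge⇔isEdge-preimage : ∀ e → IsEdge H e ⇔ IsEdge H (preimage from e)
  isEdge⇔isEdge-preimage e = aut e (preimage from e) (isImage-preimage to∘from from∘to e)

  from-pullsBackEdges : PullsBackEdges H from
  from-pullsBackEdges e = Equivalence.to (isEdge⇔isEdge-preimage e)

  to-pullsBackEdges : PullsBackEdges H to
  to-pullsBackEdges e e-edge =
    Equivalence.from (isEdge⇔isEdge-preimage (preimage to e))
      (subst (IsEdge H) (sym (preimage-cancel {h = from} to∘from e)) e-edge)

  isUnitOf-image : ∀ {W v} → IsUnitOf H W v → IsUnitOf H (preimage from W) (to v)
  isUnitOf-image = isUnitOf-preimage H to∘from from∘to to-pullsBackEdges from-pullsBackEdges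

  isUnitOf-inverseImage : ∀ {W v} → IsUnitOf H W v → IsUnitOf H (preimage to W) (from v)
  isUnitOf-inverseImage = isUnitOf-preimage H from∘to to∘from from-pullsBackEdges to-pullsBackEdges

  image-isUnitAutomorphism : IsUnitAutomorphism H (preimage from)
  image-isUnitAutomorphism = record
    { mapsUnits  = λ { W (w , W-unit) → to w , isUnitOf-image W-unit }
    ; injective  = λ W V _ _ → preimage-injective from∘to
    ; surjective = λ { W (w , W-unit) →
        preimage to W , (from w , isUnitOf-inverseImage W-unit) ,
        preimage-cancel {h = from} to∘from W }
    ; unionEdge  = λ Ws _ →
        subst (λ E → IsEdge H (⋃ Ws) ⇔ IsEdge H E) (preimage-⋃ from Ws)
              (isEdge⇔isEdge-preimage (⋃ Ws))
    }

mainTheorem15 : (H : Hypergraph) (g : Inverse (setoid (Fin (n H))) (setoid (Fin (n H)))) →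
                IsAutomorphism H g →
                Σ (Subset (n H) → Subset (n H)) λ f →
                  ((W : Subset (n H)) → IsUnit H W → (v : Fin (n H)) → v ∈ W →
                     IsUnitOf H (f W) (Inverse.to g v))
                  × IsUnitAutomorphism H f
mainTheorem15 H g aut =
  preimage (Inverse.from g) ,
  (λ { W (w , W-unit) v v∈W → isUnitOf-image H g aut (isUnitOf-member H W-unit v∈W) }) ,
  image-isUnitAutomorphism H g aut
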